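{- Suppose that $\mathcal{F}$ is a resilient $k$-graph with $\nu(\mathcal{F}) =q$. Then there is a collection $\mathcal{B}$ of $2$-element sets of vertices satisfying $\mathcal{F}\subset \langle \mathcal{B}\rangle$ and $|\mathcal{B}|\leq (kq)^2$.
   Context: A $k$-graph is a family of $k$-element subsets (edges) of a vertex set (here $[n]$). $\nu(\mathcal{F})$ is the maximum number of pairwise disjoint edges of $\mathcal{F}$. A $k$-graph $\mathcal{H}$ is resilient if for every vertex $u$, $\nu(\mathcal{H}-u)=\nu(\mathcal{H})$, where $\mathcal{H}-u$ is the $k$-graph of edges of $\mathcal{H}$ not containing $u$. For a family $\mathcal{G}$ of subsets of $[n]$ of size at most $k$, $\langle\mathcal{G}\rangle=\{F\in\binom{[n]}{k}\colon G\subset F\text{ for some }G\in\mathcal{G}\}$. -}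

module Defs where

open import Data.Nat using (ℕ)
open import Data.Fin using (Fin)
open import Data.Fin.Subset using (Subset; _∈_; _∉_; _⊆_; _∩_; Empty; ∣_∣)
open import Data.Fin.Subset.Properties using (_∈?_)
open import Data.List using (List; length; filter)
open import Data.List.Relation.Unary.All using (All)
open import Data.List.Relation.Unary.Any using (Any)
open import Data.List.Relation.Unary.AllPairs using (AllPairs)
open import Data.Product using (_×_; Σ; ∃)
open import Relation.Nullary using (¬?)
open import Relation.Binary.PropositionalEquality using (_≡_)

Family : ℕ → Set
Family n = List (Subset n)

_∈F_ : ∀ {n} → Subset n → Family n → Set
e ∈F ℱ = Any (e ≡_) ℱ

IsKGraph : ∀ {n} → ℕ → Family n → Set
IsKGraph k ℱ = All (λ e → ∣ e ∣ ≡ k) ℱ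

Disjoint : ∀ {n} → Subset n → Subset n → Set
Disjoint a b = Empty (a ∩ b)

IsMatching : ∀ {n} → Family n → List (Subset n) → Set
IsMatching ℱ M = All (_∈F ℱ) M × AllPairs Disjoint M

IsNu : ∀ {n} → Family n → ℕ → Set
IsNu ℱ q =
  Σ (List _) (λ M → IsMatching ℱ M × length M ≡ q) ×
  (∀ M → IsMatching ℱ M → length M Data.Nat.≤ q)

_─_ : ∀ {n} → Family n → Fin n → Family n
ℋ ─ u = filter (λ e → ¬? (u ∈? e)) ℋ

Resilient : ∀ {n} → Family n → Set
Resilient {n} ℋ = ∀ (u : Fin n) → ∃ λ q → IsNu ℋ q × IsNu (ℋ ─ u) q

-- F ∈ ⟨𝒢⟩ (for k-sets): |F| = k and G ⊆ F for some G ∈ 𝒢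
InGen : ∀ {n} → ℕ → Family n → Subset n → Set
InGen k 𝒢 F = ∣ F ∣ ≡ k × Any (_⊆ F) 𝒢

-- A maximum matching M of ℱ meets every edge, and so, by resilience, does
-- for each vertex x a maximum matching Mₓ of ℱ avoiding x.  An edge F
-- through a vertex x of M therefore also contains a vertex y ≠ x of Mₓ,
-- so F contains one of the (kq)² pairs {x, y} with x ∈ V(M) and y ∈ V(Mₓ).
module Submission where

open import Defs
open import Data.Nat using (ℕ; suc; _+_; _≤_; _*_; _^_)
open import Data.Nat.Properties using (≤-antisym; ≤-reflexive; 1+n≰n; *-comm; *-identityʳ)
open import Data.Fin using (Fin; zero; suc)
open import Data.Fin.Subset using (Subset; inside; outside; ⁅_⁆; _∪_; _∩_; ∣_∣; _⊆_)
  renaming (_∈_ to _∈ₛ_; _∉_ to _∉ₛ_)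
open import Data.Fin.Subset.Properties
  using (_∈?_; nonempty?; x∈p∩q⁻; x∈p∪q⁻; x∈⁅y⁆⇒x≡y; ∣⁅x⁆∣≡1; ∪-identityˡ; ∪-identityʳ)
open import Data.Vec using ([]; _∷_; here; there)
open import Data.List using (List; []; _∷_; _++_; length; map; concatMap)
open import Data.List.Properties using (length-map; length-++)
open import Data.List.Membership.Propositional using (_∈_; find; lose)
open import Data.List.Membership.Propositional.Properties using (∈-map⁺; ∈-concat⁺′; ∈-filter⁻)
open import Data.List.Relation.Unary.All as All using (All; []; _∷_)
import Data.List.Relation.Unary.All.Properties as All
open import Data.List.Relation.Unary.Any as Any using (any?)
open import Data.List.Relation.Unary.AllPairs using (_∷_)
open import Data.Product using (Σ; ∃; _×_; _,_; proj₁; proj₂)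
open import Data.Sum using (inj₁; inj₂)
open import Data.Empty using (⊥-elim)
open import Function using (_∘_)
open import Level using (Level)
open import Relation.Nullary using (yes; no; ¬?)
open import Relation.Unary using (Pred)
open import Relation.Binary.PropositionalEquality
  using (_≡_; _≢_; refl; sym; trans; cong; cong₂; subst)
open Relation.Binary.PropositionalEquality.≡-Reasoning

private
  variable
    ℓ : Level
    A B : Set
    n k q c : ℕ
    x y u : Fin n
    F e : Subset n
    ℱ M : Family n

elements : Subset n → List (Fin n)
elements []            = []
elements (inside ∷ p)  = zero ∷ map suc (elements p)
elements (outside ∷ p) = map suc (elements p)

length-elements : (p : Subset n) → length (elements p) ≡ ∣ p ∣
length-elements []            = refl
length-elements (inside ∷ p)  = cong suc (trans (length-map suc (elements p)) (length-elements p))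
length-elements (outside ∷ p) = trans (length-map suc (elements p)) (length-elements p)

∈-elements⁺ : (p : Subset n) → x ∈ₛ p → x ∈ elements p
∈-elements⁺ (inside ∷ p)  here      = Any.here refl
∈-elements⁺ (inside ∷ p)  (there i) = Any.there (∈-map⁺ suc (∈-elements⁺ p i))
∈-elements⁺ (outside ∷ p) (there i) = ∈-map⁺ suc (∈-elements⁺ p i)

elements-All⁺ : {P : Pred (Fin n) ℓ} (p : Subset n) → (∀ {x} → x ∈ₛ p → P x) → All P (elements p)
elements-All⁺ []            h = []
elements-All⁺ (inside ∷ p)  h = h here ∷ All.map⁺ (elements-All⁺ p (h ∘ there))
elements-All⁺ (outside ∷ p) h = All.map⁺ (elements-All⁺ p (h ∘ there))

length-concatMap-const : (f : A → List B) (xs : List A) →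
  All (λ x → length (f x) ≡ c) xs → length (concatMap f xs) ≡ length xs * c
length-concatMap-const         f []       []                 = refl
length-concatMap-const {c = c} f (x ∷ xs) (|fx|≡c ∷ |fxs|≡c) = begin
  length (f x ++ concatMap f xs)          ≡⟨ length-++ (f x) ⟩
  length (f x) + length (concatMap f xs)  ≡⟨ cong₂ _+_ |fx|≡c (length-concatMap-const f xs |fxs|≡c) ⟩
  c + length xs * c                       ∎

vertices : Family n → List (Fin n)
vertices = concatMap elements

∈-vertices⁺ : e ∈ M → x ∈ₛ e → x ∈ vertices M
∈-vertices⁺ {e = e} e∈M x∈e = ∈-concat⁺′ (∈-elements⁺ e x∈e) (∈-map⁺ elements e∈M)

vertices-All⁺ : {P : Pred (Fin n) ℓ} → All (λ e → ∀ {x} → x ∈ₛ e → P x) M → All P (vertices M)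
vertices-All⁺ h = All.concat⁺ (All.map⁺ (All.map (elements-All⁺ _) h))

length-vertices : All (λ e → ∣ e ∣ ≡ k) M → length (vertices M) ≡ length M * k
length-vertices {M = M} |M|≡k =
  length-concatMap-const elements M (All.map (λ {e} |e|≡k → trans (length-elements e) |e|≡k) |M|≡k)

pair : Fin n → Fin n → Subset n
pair x y = ⁅ x ⁆ ∪ ⁅ y ⁆

∣pair∣≡2 : x ≢ y → ∣ pair x y ∣ ≡ 2
∣pair∣≡2 {x = zero}  {zero}  x≢y = ⊥-elim (x≢y refl)
∣pair∣≡2 {x = zero}  {suc y} x≢y = cong suc (trans (cong ∣_∣ (∪-identityˡ ⁅ y ⁆)) (∣⁅x⁆∣≡1 y))
∣pair∣≡2 {x = suc x} {zero}  x≢y = cong suc (trans (cong ∣_∣ (∪-identityʳ ⁅ x ⁆)) (∣⁅x⁆∣≡1 x))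
∣pair∣≡2 {x = suc x} {suc y} x≢y = ∣pair∣≡2 (x≢y ∘ cong suc)

pair⊆ : x ∈ₛ F → y ∈ₛ F → pair x y ⊆ F
pair⊆ {x = x} {y = y} x∈F y∈F z∈pair with x∈p∪q⁻ ⁅ x ⁆ ⁅ y ⁆ z∈pair
... | inj₁ z∈⁅x⁆ = subst (_∈ₛ _) (sym (x∈⁅y⁆⇒x≡y x z∈⁅x⁆)) x∈F
... | inj₂ z∈⁅y⁆ = subst (_∈ₛ _) (sym (x∈⁅y⁆⇒x≡y y z∈⁅y⁆)) y∈F

pairsFrom : List (Fin n) → (Fin n → List (Fin n)) → Family n
pairsFrom X Y = concatMap (λ x → map (pair x) (Y x)) X

pair∈pairsFrom : ∀ {X Y} → x ∈ X → y ∈ Y x → pair x y ∈ pairsFrom X Y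
pair∈pairsFrom {x = x} x∈X y∈Yx = ∈-concat⁺′ (∈-map⁺ (pair x) y∈Yx) (∈-map⁺ _ x∈X)

pairsFrom-∣∣≡2 : (X : List (Fin n)) {Y : Fin n → List (Fin n)} →
  (∀ x → All (x ≢_) (Y x)) → All (λ B → ∣ B ∣ ≡ 2) (pairsFrom X Y)
pairsFrom-∣∣≡2 X x≢Yx =
  All.concat⁺ (All.map⁺ (All.universal (λ x → All.map⁺ (All.map ∣pair∣≡2 (x≢Yx x))) X))

length-pairsFrom : (X : List (Fin n)) {Y : Fin n → List (Fin n)} →
  (∀ x → length (Y x) ≡ c) → length (pairsFrom X Y) ≡ length X * c
length-pairsFrom X {Y} |Yx|≡c =
  length-concatMap-const _ X (All.universal (λ x → trans (length-map (pair x) (Y x)) (|Yx|≡c x)) X)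

IsNu-unique : ∀ {q′} → IsNu ℱ q → IsNu ℱ q′ → q ≡ q′
IsNu-unique ((M , M-matching , |M|≡q) , ν≤q) ((M′ , M′-matching , |M′|≡q′) , ν≤q′) =
  ≤-antisym (subst (_≤ _) |M|≡q (ν≤q′ M M-matching)) (subst (_≤ _) |M′|≡q′ (ν≤q M′ M′-matching))

maximumMatching-meets : IsNu ℱ q → IsMatching ℱ M → length M ≡ q →
  F ∈F ℱ → ∃ λ x → x ∈ₛ F × x ∈ vertices M
maximumMatching-meets {ℱ = ℱ} {M = M} {F = F} (_ , ν≤q) (M⊆ℱ , M-disjoint) |M|≡q F∈ℱ
  with any? (λ e → nonempty? (F ∩ e)) M
... | yes F∩M≢∅ =
  let e , e∈M , x , x∈F∩e = find F∩M≢∅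
      x∈F , x∈e = x∈p∩q⁻ F e x∈F∩e
  in x , x∈F , ∈-vertices⁺ e∈M x∈e
... | no F∩M≡∅ = ⊥-elim (1+n≰n (subst (λ m → suc m ≤ _) |M|≡q (ν≤q (F ∷ M) F∷M-matching)))
  where
  F∷M-matching : IsMatching ℱ (F ∷ M)
  F∷M-matching = F∈ℱ ∷ M⊆ℱ , All.¬Any⇒All¬ M F∩M≡∅ ∷ M-disjoint

∈-─⁻ : e ∈F (ℱ ─ u) → e ∈F ℱ × u ∉ₛ e
∈-─⁻ {u = u} = ∈-filter⁻ (λ e → ¬? (u ∈? e))

record AvoidingMaximumMatching (ℱ : Family n) (q : ℕ) (u : Fin n) : Set where
  field
    edges    : Family n
    matching : IsMatching ℱ edges
    size     : length edges ≡ q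
    avoids   : All (u ∉ₛ_) edges

avoidingMaximumMatching : Resilient ℱ → IsNu ℱ q → (u : Fin n) → AvoidingMaximumMatching ℱ q u
avoidingMaximumMatching {ℱ = ℱ} resilient ν u
  with resilient u
... | q′ , ν′ , (M , (M⊆ℱ─u , M-disjoint) , |M|≡q′) , _ = record
  { edges    = M
  ; matching = All.map (proj₁ ∘ ∈-─⁻ {ℱ = ℱ}) M⊆ℱ─u , M-disjoint
  ; size     = trans |M|≡q′ (IsNu-unique ν′ ν)
  ; avoids   = All.map (proj₂ ∘ ∈-─⁻ {ℱ = ℱ}) M⊆ℱ─u
  }

∉-vertices : All (u ∉ₛ_) M → All (u ≢_) (vertices M)
∉-vertices = vertices-All⁺ ∘ All.map (λ u∉e {_} x∈e u≡x → u∉e (subst (_∈ₛ _) (sym u≡x) x∈e))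

length-vertices-matching : IsKGraph k ℱ → IsMatching ℱ M → length M ≡ q →
  length (vertices M) ≡ q * k
length-vertices-matching {k = k} ℱ-uniform (M⊆ℱ , _) |M|≡q =
  trans (length-vertices (All.map (All.lookup ℱ-uniform) M⊆ℱ)) (cong (_* k) |M|≡q)

square : ∀ m → m * m ≡ m ^ 2
square m = cong (m *_) (sym (*-identityʳ m))

lemma2p2 : ∀ (n k q : ℕ) (ℱ : Family n) → 1 ≤ k → IsKGraph k ℱ →
    Resilient ℱ → IsNu ℱ q →
    Σ (Family n) (λ ℬ → All (λ B → ∣ B ∣ ≡ 2) ℬ ×
      (∀ F → F ∈F ℱ → InGen k ℬ F) × length ℬ ≤ (k * q) ^ 2)
lemma2p2 n k q ℱ _ ℱ-uniform resilient ν@((M , M-matching , |M|≡q) , _) =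
  ℬ , pairsFrom-∣∣≡2 (vertices M) (∉-vertices ∘ Mₓ.avoids) , ℬ-covers , ≤-reflexive |ℬ|≡[kq]²
  where
  module Mₓ (x : Fin n) = AvoidingMaximumMatching (avoidingMaximumMatching resilient ν x)

  ℬ : Family n
  ℬ = pairsFrom (vertices M) (vertices ∘ Mₓ.edges)

  ℬ-covers : ∀ F → F ∈F ℱ → InGen k ℬ F
  ℬ-covers F F∈ℱ =
    let x , x∈F , x∈M  = maximumMatching-meets ν M-matching |M|≡q F∈ℱ
        y , y∈F , y∈Mₓ = maximumMatching-meets ν (Mₓ.matching x) (Mₓ.size x) F∈ℱ
    in All.lookup ℱ-uniform F∈ℱ , lose {P = _⊆ F} (pair∈pairsFrom x∈M y∈Mₓ) (pair⊆ x∈F y∈F)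

  |ℬ|≡[kq]² : length ℬ ≡ (k * q) ^ 2
  |ℬ|≡[kq]² = begin
    length ℬ                       ≡⟨ length-pairsFrom (vertices M) (λ x →
                                        length-vertices-matching ℱ-uniform (Mₓ.matching x) (Mₓ.size x)) ⟩
    length (vertices M) * (q * k)  ≡⟨ cong (_* (q * k)) (length-vertices-matching ℱ-uniform M-matching |M|≡q) ⟩
    (q * k) * (q * k)              ≡⟨ cong (λ m → m * m) (*-comm q k) ⟩
    (k * q) * (k * q)              ≡⟨ square (k * q) ⟩
    (k * q) ^ 2                    ∎
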